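{- Let $p \geq 5$ be prime and $A \subseteq \mathbb{Z}_p^2$ with $|A| = 2p+1$. Let $H$ be a subgroup of $\mathbb{Z}_p^2$ of order $p$, with cosets indexed $H_0 = H, H_1, \dots, H_{p-1}$ so that $H_i + H_j = H_{i+j}$ (indices mod $p$), and put $A_i = A \cap H_i$. Assume $|A_0| \geq |A_i|$ for all $i$, and that $|A_0| \geq \frac{p+3}{2}$. Let $\ell$ be the number of $i \in \{1,\dots,p-1\}$ with $|A_0| + |A_i| - 1 \geq p$, and let $s$ be the number of $i \in \{1,\dots,p-1\}$ with $A_i \neq \emptyset$ and $|A_0| + |A_i| - 1 < p$. Suppose $\ell = 1$, and let $\beta \in \{1,\dots,p-1\}$ be the unique index with $|A_0| + |A_\beta| - 1 \geq p$. If $|\hat{2}A| \leq 4p-1$, where $\hat{2}A = \{a_1+a_2 \mid a_1,a_2 \in A, a_1 \neq a_2\}$, then either $s = 1$, or $s = 2$ and $|A_\beta| = |A_0|$. -}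

module Defs where

open import Data.Bool using (Bool; true; false; _∧_; not; if_then_else_)
open import Data.Nat using (ℕ; _+_; NonZero)
open import Data.Nat.DivMod using (_mod_)
open import Data.Fin using (Fin; toℕ)
open import Data.Fin.Properties using () renaming (_≟_ to _≟F_)
open import Data.Product using (_×_; _,_; Σ)
open import Function.Bundles using (_⇔_)
open import Data.Product.Properties using (≡-dec)
open import Data.List using (List; allFin; cartesianProduct; map)
open import Data.Bool.ListAction using (any)
open import Data.Nat.ListAction using (sum)
open import Relation.Nullary.Decidable using (⌊_⌋)
open import Relation.Binary.PropositionalEquality using (_≡_)

Zp : ℕ → Set
Zp p = Fin p

_⊕_ : ∀ {p} .{{_ : NonZero p}} → Zp p → Zp p → Zp p
_⊕_ {p} a b = (toℕ a + toℕ b) mod p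

0ₚ : ∀ p .{{_ : NonZero p}} → Zp p
0ₚ p = 0 mod p

G : ℕ → Set
G p = Zp p × Zp p

_⊞_ : ∀ {p} .{{_ : NonZero p}} → G p → G p → G p
(a , b) ⊞ (c , d) = (a ⊕ c , b ⊕ d)

0G : ∀ p .{{_ : NonZero p}} → G p
0G p = (0ₚ p , 0ₚ p)

_≟G_ : ∀ {p} (x y : G p) → Bool
x ≟G y = ⌊ ≡-dec _≟F_ _≟F_ x y ⌋

elems : ∀ p → List (G p)
elems p = cartesianProduct (allFin p) (allFin p)

-- subsets of a finite set are given by their characteristic functions;
-- cardinality = number of elements on which the function is true
count : ∀ {A : Set} → List A → (A → Bool) → ℕ
count xs f = sum (map (λ x → if f x then 1 else 0) xs)

card : ∀ p → (G p → Bool) → ℕ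
card p S = count (elems p) S

countZp : ∀ p → (Zp p → Bool) → ℕ
countZp p f = count (allFin p) f

record IsSubgroup (p : ℕ) .{{_ : NonZero p}} (H : G p → Bool) : Set where
  field
    has-zero : H (0G p) ≡ true
    closed-+ : ∀ x y → H x ≡ true → H y ≡ true → H (x ⊞ y) ≡ true
    closed-neg : ∀ x → H x ≡ true → Σ (G p) λ y → (H y ≡ true) × (x ⊞ y ≡ 0G p)

-- An indexing of the cosets of H by ℤ_p: ι x = i  iff  x ∈ H_i.
-- H_0 = H, every index is used, and H_i + H_j = H_{i+j}.
record CosetIndexing (p : ℕ) .{{_ : NonZero p}} (H : G p → Bool) (ι : G p → Zp p) : Set where
  field
    zero-coset : ∀ x → (H x ≡ true) ⇔ (ι x ≡ 0ₚ p)
    onto : ∀ i → Σ (G p) λ x → ι x ≡ i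
    additive : ∀ x y → ι (x ⊞ y) ≡ ι x ⊕ ι y

part : ∀ {p} → (G p → Bool) → (G p → Zp p) → Zp p → (G p → Bool)
part A ι i x = A x ∧ (⌊ ι x ≟F i ⌋)

sumHat : ∀ p .{{_ : NonZero p}} → (G p → Bool) → (G p → Bool)
sumHat p A z = any (λ a₁ → any (λ a₂ → A a₁ ∧ A a₂ ∧ not (a₁ ≟G a₂) ∧ ((a₁ ⊞ a₂) ≟G z)) (elems p)) (elems p)

-- Fix coordinates (i , t) on ℤₚ² in which i is the index of the coset of H, so that each A_i
-- becomes a subset of ℤₚ and row i of 2̂A contains A_j + A_k whenever j + k = i and j ≠ k,
-- as well as the restricted sumset of A_0 when i = 0. Since 2|A_0| ≥ p + 3, every t ∈ ℤₚ has
-- at least two representations t = x + y with x, y ∈ A_0, and as p is odd one of them has x ≠ y: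
-- row 0 of 2̂A is full. Row β is full by pigeonhole, as |A_0| + |A_β| > p. Every other row i
-- counted by s has at least |A_0| + |A_i| − 1 elements by Cauchy–Davenport, and all remaining
-- rows of A are empty because ℓ = 1. Summing over rows and using Σ |A_i| = 2p + 1,
--   4p − 1 ≥ |2̂A| ≥ 2p + s (|A_0| − 1) + (2p + 1 − |A_0| − |A_β|),
-- that is s (|A_0| − 1) + 2 ≤ |A_0| + |A_β| ≤ 2|A_0|, which leaves only s = 1, or s = 2 with
-- |A_β| = |A_0|; s = 0 is impossible since then |A_0| + |A_β| = 2p + 1.

module Submission where

open import Defs
open import Data.Bool using (Bool; true; false; T; not; _∧_; _∨_; if_then_else_)
open import Data.Bool.ListAction using (any)
open import Data.Bool.Properties using (T-∧; T-∨; ∧-comm; ∧-identityʳ; ∧-zeroʳ)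
open import Data.Empty using (⊥-elim)
open import Data.Fin using (Fin; toℕ)
open import Data.Fin.Properties using (toℕ-fromℕ<; toℕ-injective; toℕ<n; any?; all?) renaming (_≟_ to _≟F_)
open import Data.List using (List; []; _∷_; map; length; filter; allFin; cartesianProduct; _++_)
open import Data.List.Membership.Propositional using (_∈_; _∉_; find; lose)
open import Data.List.Membership.Propositional.Properties using (∈-filter⁺; ∈-filter⁻; ∈-map⁺; ∈-allFin; ∈-cartesianProduct⁺)
open import Data.List.Properties using (length-tabulate; map-++)
open import Data.List.Membership.Propositional.Properties.WithK using (unique∧set⇒bag)
open import Data.List.Relation.Binary.BagAndSetEquality using (∼bag⇒↭)
open import Data.List.Relation.Binary.Permutation.Propositional using (_↭_; ↭-prep; ↭-trans)
import Data.List.Relation.Binary.Permutation.Propositional.Properties as Perm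
open import Data.List.Relation.Unary.All as All using (All)
open import Data.List.Relation.Unary.AllPairs using ([]; _∷_)
open import Data.List.Relation.Unary.Any using (Any; here; there; satisfied)
open import Data.List.Relation.Unary.Any.Properties using (any⁺; any⁻)
open import Data.List.Relation.Unary.Unique.Propositional using (Unique)
import Data.List.Relation.Unary.Unique.Propositional.Properties as Unique
open import Data.Nat using (ℕ; NonZero; zero; suc; ≢-nonZero; _⊓_; _≤?_; _<?_; _+_; _*_; _∸_; _≤_; _<_; z≤n; s≤s; s≤s⁻¹)
open import Data.Nat.Coprimality using (Coprime; coprime-Bézout)
open import Data.Nat.Divisibility using (∣⇒≤)
open import Data.Nat.DivMod using (_%_; _mod_; %-distribˡ-+; %-distribˡ-*; m%n%n≡m%n; m<n⇒m%n≡m; n%n≡0; [m+n]%n≡m%n; [m+kn]%n≡m%n)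
open import Data.Nat.GCD using (module Bézout)
open import Data.Nat.Primality using (Prime; prime⇒irreducible)
open import Data.Nat.Tactic.RingSolver using (solve-∀)
open import Data.Nat.ListAction using (sum)
open import Data.Nat.ListAction.Properties using (sum-↭; sum-++)
open import Data.Nat.Properties
open import Algebra.Properties.CommutativeSemigroup +-commutativeSemigroup using () renaming (interchange to +-interchange)
open import Data.Product.Properties using (≡-dec)
open import Data.Product using (Σ; ∃; ∃₂; _×_; _,_; proj₁; proj₂; swap)
open import Data.Product.Algebra using (×-comm)
open import Data.Sum using (_⊎_; inj₁; inj₂)
open import Function.Construct.Composition using (_↔-∘_)
open import Function using (_∘_; id; _↔_; mk↔ₛ′; Inverse; mk⇔; Equivalence)
open import Relation.Binary.Definitions using (DecidableEquality)
open import Relation.Binary.PropositionalEquality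
open import Relation.Nullary using (¬_; Dec; yes; no; ¬?; contradiction)
open import Relation.Nullary.Decidable using (⌊_⌋; T?; _×-dec_; decidable-stable; dec-true; dec-false; isYes≗does; fromWitness; fromWitnessFalse; toWitness; toWitnessFalse)

-- Counting over lists

𝟙 : Bool → ℕ
𝟙 b = if b then 1 else 0

∑ : {X : Set} → List X → (X → ℕ) → ℕ
∑ xs w = sum (map w xs)

¬T⇒≡false : ∀ {b} → ¬ T b → b ≡ false
¬T⇒≡false {false} _  = refl
¬T⇒≡false {true}  ¬t = contradiction _ ¬t

count-map : {X Y : Set} (xs : List X) {g : X → Y} {f : Y → Bool} → count (map g xs) f ≡ count xs (f ∘ g)
count-map []       = refl
count-map (x ∷ xs) = cong (_ +_) (count-map xs)

module _ {X : Set} where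

  count-cong : ∀ xs {f g : X → Bool} → (∀ x → f x ≡ g x) → count xs f ≡ count xs g
  count-cong []       f≗g = refl
  count-cong (x ∷ xs) f≗g = cong₂ (λ b n → 𝟙 b + n) (f≗g x) (count-cong xs f≗g)

  count-mono : ∀ xs {f g : X → Bool} → (∀ x → T (f x) → T (g x)) → count xs f ≤ count xs g
  count-mono []       f⊆g = z≤n
  count-mono (x ∷ xs) {f} {g} f⊆g with f x | g x | f⊆g x
  ... | true  | true  | _     = s≤s (count-mono xs f⊆g)
  ... | true  | false | fx⇒gx = ⊥-elim (fx⇒gx _)
  ... | false | true  | _     = m≤n⇒m≤1+n (count-mono xs f⊆g)
  ... | false | false | _     = count-mono xs f⊆g

  count-mono-< : ∀ xs {f g : X → Bool} → (∀ x → T (f x) → T (g x)) →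
                 ∀ {y} → y ∈ xs → ¬ T (f y) → T (g y) → count xs f < count xs g
  count-mono-< (x ∷ xs) {f} {g} f⊆g (here refl) ¬fx gx with f x | g x
  ... | true  | _     = ⊥-elim (¬fx _)
  ... | false | true  = s≤s (count-mono xs f⊆g)
  count-mono-< (x ∷ xs) {f} {g} f⊆g (there y∈xs) ¬fy gy with f x | g x | f⊆g x
  ... | true  | true  | _     = s≤s (count-mono-< xs f⊆g y∈xs ¬fy gy)
  ... | true  | false | fx⇒gx = ⊥-elim (fx⇒gx _)
  ... | false | true  | _     = m<n⇒m<1+n (count-mono-< xs f⊆g y∈xs ¬fy gy)
  ... | false | false | _     = count-mono-< xs f⊆g y∈xs ¬fy gy

  count≤length : ∀ xs {f : X → Bool} → count xs f ≤ length xs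
  count≤length []           = z≤n
  count≤length (x ∷ xs) {f} with f x
  ... | true  = s≤s (count≤length xs)
  ... | false = m≤n⇒m≤1+n (count≤length xs)

  count-all : ∀ xs {f : X → Bool} → (∀ x → T (f x)) → count xs f ≡ length xs
  count-all []           all = refl
  count-all (x ∷ xs) {f} all with f x | all x
  ... | true | _ = cong suc (count-all xs all)

  count-pos⇒Any : ∀ xs {f : X → Bool} → 0 < count xs f → Any (T ∘ f) xs
  count-pos⇒Any (x ∷ xs) {f} pos with f x in fx≡
  ... | true  = here (subst T (sym fx≡) _)
  ... | false = there (count-pos⇒Any xs pos)

  Any⇒count-pos : ∀ xs {f : X → Bool} → Any (T ∘ f) xs → 0 < count xs f
  Any⇒count-pos (x ∷ xs) {f} (here fx) with f x
  ... | true  = s≤s z≤n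
  ... | false = ⊥-elim fx
  Any⇒count-pos (x ∷ xs) {f} (there any) with f x
  ... | true  = s≤s z≤n
  ... | false = Any⇒count-pos xs any

  count-∨+count-∧ : ∀ xs (f g : X → Bool) →
    count xs (λ x → f x ∨ g x) + count xs (λ x → f x ∧ g x) ≡ count xs f + count xs g
  count-∨+count-∧ []       f g = refl
  count-∨+count-∧ (x ∷ xs) f g with f x | g x
  ... | true  | true  = cong suc (trans (+-suc _ _) (trans (cong suc (count-∨+count-∧ xs f g)) (sym (+-suc _ _))))
  ... | true  | false = cong suc (count-∨+count-∧ xs f g)
  ... | false | true  = trans (cong suc (count-∨+count-∧ xs f g)) (sym (+-suc _ _))
  ... | false | false = count-∨+count-∧ xs f g

  count≥2⇒distinct : ∀ {xs : List X} {f : X → Bool} → Unique xs → 2 ≤ count xs f →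
                     ∃₂ λ x y → x ≢ y × T (f x) × T (f y)
  count≥2⇒distinct {x ∷ xs} {f} (x∉xs ∷ xs!) two with f x in fx≡
  ... | true  = let y , y∈xs , fy = find (count-pos⇒Any xs (s≤s⁻¹ two)) in
                x , y , All.lookup x∉xs y∈xs , subst T (sym fx≡) _ , fy
  ... | false = count≥2⇒distinct xs! two

  ∑-↭ : ∀ {xs ys : List X} (w : X → ℕ) → xs ↭ ys → ∑ xs w ≡ ∑ ys w
  ∑-↭ w xs↭ys = sum-↭ (Perm.map⁺ w xs↭ys)

  ↭-complete : ∀ {xs ys : List X} → Unique xs → Unique ys → (∀ x → x ∈ xs) → (∀ x → x ∈ ys) → xs ↭ ys
  ↭-complete xs! ys! ∈xs ∈ys = ∼bag⇒↭ (unique∧set⇒bag xs! ys! (mk⇔ (λ _ → ∈ys _) (λ _ → ∈xs _)))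

  count-∘-↔ : ∀ {xs : List X} → Unique xs → (∀ x → x ∈ xs) → (φ : X ↔ X) (f : X → Bool) →
              count xs (f ∘ Inverse.to φ) ≡ count xs f
  count-∘-↔ {xs} xs! ∈xs φ f = begin
    count xs (f ∘ to)      ≡⟨ count-map xs ⟨
    count (map to xs) f    ≡⟨ ∑-↭ _ (↭-complete (Unique.map⁺ injective xs!) xs! ∈φxs ∈xs) ⟩
    count xs f             ∎
    where
    open ≡-Reasoning
    open Inverse φ
    injective : ∀ {x y} → to x ≡ to y → x ≡ y
    injective {x} {y} e = trans (sym (strictlyInverseʳ x)) (trans (cong from e) (strictlyInverseʳ y))
    ∈φxs : ∀ x → x ∈ map to xs
    ∈φxs x = subst (_∈ map to xs) (strictlyInverseˡ x) (∈-map⁺ to (∈xs (from x)))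

  ↭-remove : ∀ {xs : List X} {i} (_≟_ : DecidableEquality X) → Unique xs → i ∈ xs →
             xs ↭ i ∷ filter (λ x → ¬? (x ≟ i)) xs
  ↭-remove {xs} {i} _≟_ xs! i∈xs =
    ∼bag⇒↭ (unique∧set⇒bag xs! (i∉rest ∷ Unique.filter⁺ _ xs!) (mk⇔ to from))
    where
    ≢i? = λ x → ¬? (x ≟ i)
    rest = filter ≢i? xs
    i∉rest : All (i ≢_) rest
    i∉rest = All.tabulate λ x∈rest i≡x → proj₂ (∈-filter⁻ ≢i? {xs = xs} x∈rest) (sym i≡x)
    to : ∀ {x} → x ∈ xs → x ∈ i ∷ rest
    to {x} x∈xs with x ≟ i
    ... | yes refl = here refl
    ... | no  x≢i  = there (∈-filter⁺ ≢i? x∈xs x≢i)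
    from : ∀ {x} → x ∈ i ∷ rest → x ∈ xs
    from (here refl)    = i∈xs
    from (there x∈rest) = proj₁ (∈-filter⁻ ≢i? {xs = xs} x∈rest)

  ∑-+ : ∀ xs (v w : X → ℕ) → ∑ xs (λ x → v x + w x) ≡ ∑ xs v + ∑ xs w
  ∑-+ []       v w = refl
  ∑-+ (x ∷ xs) v w = trans (cong (v x + w x +_) (∑-+ xs v w)) (+-interchange (v x) (w x) (∑ xs v) (∑ xs w))

  ∑-mono : ∀ xs {v w : X → ℕ} → (∀ {x} → x ∈ xs → v x ≤ w x) → ∑ xs v ≤ ∑ xs w
  ∑-mono []       v≤w = z≤n
  ∑-mono (x ∷ xs) v≤w = +-mono-≤ (v≤w (here refl)) (∑-mono xs (v≤w ∘ there))

  ∑-zero : ∀ xs {w : X → ℕ} → (∀ {x} → x ∈ xs → w x ≡ 0) → ∑ xs w ≡ 0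
  ∑-zero []       w≡0 = refl
  ∑-zero (x ∷ xs) w≡0 = cong₂ _+_ (w≡0 (here refl)) (∑-zero xs (w≡0 ∘ there))

  ∑-if : ∀ xs (f : X → Bool) c → ∑ xs (λ x → if f x then c else 0) ≡ count xs f * c
  ∑-if []       f c = refl
  ∑-if (x ∷ xs) f c with f x
  ... | true  = cong (c +_) (∑-if xs f c)
  ... | false = ∑-if xs f c

  ∑-pick : ∀ {xs : List X} {i} (_≟_ : DecidableEquality X) (w : X → ℕ) → Unique xs → i ∈ xs →
           (∀ {j} → j ≢ i → w j ≡ 0) → ∑ xs w ≡ w i
  ∑-pick {xs} {i} _≟_ w xs! i∈xs w≡0 = begin
    ∑ xs w                                    ≡⟨ ∑-↭ w (↭-remove _≟_ xs! i∈xs) ⟩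
    w i + ∑ (filter (λ x → ¬? (x ≟ i)) xs) w  ≡⟨ cong (w i +_) (∑-zero _ (w≡0 ∘ proj₂ ∘ ∈-filter⁻ (λ x → ¬? (x ≟ i)) {xs = xs})) ⟩
    w i + 0                                   ≡⟨ +-identityʳ _ ⟩
    w i                                       ∎
    where open ≡-Reasoning

  ∑-cong : ∀ xs {v w : X → ℕ} → (∀ x → v x ≡ w x) → ∑ xs v ≡ ∑ xs w
  ∑-cong []       v≗w = refl
  ∑-cong (x ∷ xs) v≗w = cong₂ _+_ (v≗w x) (∑-cong xs v≗w)

  count-++ : ∀ xs ys (f : X → Bool) → count (xs ++ ys) f ≡ count xs f + count ys f
  count-++ xs ys f = trans (cong sum (map-++ (𝟙 ∘ f) xs ys)) (sum-++ (map (𝟙 ∘ f) xs) _)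

  count-∧-const : ∀ xs (f : X → Bool) b → count xs (λ x → f x ∧ b) ≡ (if b then count xs f else 0)
  count-∧-const xs f true  = count-cong xs (λ x → ∧-identityʳ (f x))
  count-∧-const xs f false = ∑-zero xs (λ {x} _ → cong 𝟙 (∧-zeroʳ (f x)))

  count≡1⇒unique : ∀ {xs : List X} {f : X → Bool} (_≟_ : DecidableEquality X) → Unique xs →
                   count xs f ≡ 1 → ∀ {y z} → y ∈ xs → z ∈ xs → T (f y) → T (f z) → z ≡ y
  count≡1⇒unique {xs} {f} _≟_ xs! count≡1 {y} {z} y∈xs z∈xs fy fz with z ≟ y
  ... | yes z≡y = z≡y
  ... | no  z≢y = contradiction count≡1 (>⇒≢ (begin-strict
    1                                                ≡⟨ 𝟙-T fy ⟨
    𝟙 (f y) + 0                                      <⟨ +-monoʳ-< (𝟙 (f y)) (Any⇒count-pos _ (lose (∈-filter⁺ (λ x → ¬? (x ≟ y)) z∈xs z≢y) fz)) ⟩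
    𝟙 (f y) + count (filter (λ x → ¬? (x ≟ y)) xs) f ≡⟨ ∑-↭ (𝟙 ∘ f) (↭-remove _≟_ xs! y∈xs) ⟨
    count xs f                                       ∎))
    where
    open ≤-Reasoning
    𝟙-T : ∀ {b} → T b → 𝟙 b + 0 ≡ 1
    𝟙-T {true} _ = refl

count-cartesianProduct : {X Y : Set} (xs : List X) (ys : List Y) (f : X × Y → Bool) →
  count (cartesianProduct xs ys) f ≡ ∑ xs (λ x → count ys (λ y → f (x , y)))
count-cartesianProduct []       ys f = refl
count-cartesianProduct (x ∷ xs) ys f = begin
  count (map (x ,_) ys ++ cartesianProduct xs ys) f                   ≡⟨ count-++ (map (x ,_) ys) _ f ⟩
  count (map (x ,_) ys) f + count (cartesianProduct xs ys) f         ≡⟨ cong₂ _+_ (count-map ys) (count-cartesianProduct xs ys f) ⟩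
  count ys (λ y → f (x , y)) + ∑ xs (λ x → count ys (λ y → f (x , y))) ∎
  where open ≡-Reasoning

-- The field ℤₚ, its subsets and sumsets

module ℤₚ (n : ℕ) where

  p : ℕ
  p = suc n

  0# 1# : Fin p
  0# = 0ₚ p
  1# = 1 mod p

  _⊗_ : Fin p → Fin p → Fin p
  a ⊗ b = (toℕ a * toℕ b) mod p

  -_ : Fin p → Fin p
  - a = (p ∸ toℕ a) mod p

  _⊖_ : Fin p → Fin p → Fin p
  a ⊖ b = a ⊕ (- b)

  toℕ-mod : ∀ m → toℕ (m mod p) ≡ m % p
  toℕ-mod m = toℕ-fromℕ< _

  toℕ-⊕ : ∀ a b → toℕ (a ⊕ b) ≡ (toℕ a + toℕ b) % p
  toℕ-⊕ a b = toℕ-mod (toℕ a + toℕ b)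

  toℕ-⊗ : ∀ a b → toℕ (a ⊗ b) ≡ (toℕ a * toℕ b) % p
  toℕ-⊗ a b = toℕ-mod (toℕ a * toℕ b)

  toℕ-%p : ∀ a → toℕ a % p ≡ toℕ a
  toℕ-%p a = m<n⇒m%n≡m (toℕ<n a)

  mod-toℕ : ∀ a → toℕ a mod p ≡ a
  mod-toℕ a = toℕ-injective (trans (toℕ-mod (toℕ a)) (toℕ-%p a))

  %-absorbˡ-+ : ∀ x y → (x % p + y) % p ≡ (x + y) % p
  %-absorbˡ-+ x y = begin
    (x % p + y) % p          ≡⟨ %-distribˡ-+ (x % p) y p ⟩
    (x % p % p + y % p) % p  ≡⟨ cong (λ z → (z + y % p) % p) (m%n%n≡m%n x p) ⟩
    (x % p + y % p) % p      ≡⟨ %-distribˡ-+ x y p ⟨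
    (x + y) % p              ∎
    where open ≡-Reasoning

  %-absorbʳ-+ : ∀ x y → (x + y % p) % p ≡ (x + y) % p
  %-absorbʳ-+ x y = trans (cong (_% p) (+-comm x _)) (trans (%-absorbˡ-+ y x) (cong (_% p) (+-comm y x)))

  %-absorbˡ-* : ∀ x y → (x % p * y) % p ≡ (x * y) % p
  %-absorbˡ-* x y = begin
    (x % p * y) % p          ≡⟨ %-distribˡ-* (x % p) y p ⟩
    (x % p % p * (y % p)) % p ≡⟨ cong (λ z → (z * (y % p)) % p) (m%n%n≡m%n x p) ⟩
    (x % p * (y % p)) % p    ≡⟨ %-distribˡ-* x y p ⟨
    (x * y) % p              ∎
    where open ≡-Reasoning

  %-absorbʳ-* : ∀ x y → (x * (y % p)) % p ≡ (x * y) % p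
  %-absorbʳ-* x y = trans (cong (_% p) (*-comm x _)) (trans (%-absorbˡ-* y x) (cong (_% p) (*-comm y x)))

  ⊕-comm : ∀ a b → a ⊕ b ≡ b ⊕ a
  ⊕-comm a b = cong (_mod p) (+-comm (toℕ a) (toℕ b))

  ⊕-assoc : ∀ a b c → (a ⊕ b) ⊕ c ≡ a ⊕ (b ⊕ c)
  ⊕-assoc a b c = toℕ-injective (begin
    toℕ ((a ⊕ b) ⊕ c)                ≡⟨ toℕ-⊕ (a ⊕ b) c ⟩
    (toℕ (a ⊕ b) + toℕ c) % p        ≡⟨ cong (λ z → (z + toℕ c) % p) (toℕ-⊕ a b) ⟩
    ((toℕ a + toℕ b) % p + toℕ c) % p ≡⟨ %-absorbˡ-+ (toℕ a + toℕ b) (toℕ c) ⟩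
    (toℕ a + toℕ b + toℕ c) % p      ≡⟨ cong (_% p) (+-assoc (toℕ a) (toℕ b) (toℕ c)) ⟩
    (toℕ a + (toℕ b + toℕ c)) % p    ≡⟨ %-absorbʳ-+ (toℕ a) (toℕ b + toℕ c) ⟨
    (toℕ a + (toℕ b + toℕ c) % p) % p ≡⟨ cong (λ z → (toℕ a + z) % p) (toℕ-⊕ b c) ⟨
    (toℕ a + toℕ (b ⊕ c)) % p        ≡⟨ toℕ-⊕ a (b ⊕ c) ⟨
    toℕ (a ⊕ (b ⊕ c))                ∎)
    where open ≡-Reasoning

  ⊕-identityˡ : ∀ a → 0# ⊕ a ≡ a
  ⊕-identityˡ = mod-toℕ

  ⊕-identityʳ : ∀ a → a ⊕ 0# ≡ a
  ⊕-identityʳ a = trans (⊕-comm a 0#) (⊕-identityˡ a)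

  ⊕-inverseʳ : ∀ a → a ⊕ (- a) ≡ 0#
  ⊕-inverseʳ a = toℕ-injective (begin
    toℕ (a ⊕ (- a))                ≡⟨ toℕ-⊕ a (- a) ⟩
    (toℕ a + toℕ (- a)) % p        ≡⟨ cong (λ z → (toℕ a + z) % p) (toℕ-mod (p ∸ toℕ a)) ⟩
    (toℕ a + (p ∸ toℕ a) % p) % p  ≡⟨ %-absorbʳ-+ (toℕ a) (p ∸ toℕ a) ⟩
    (toℕ a + (p ∸ toℕ a)) % p      ≡⟨ cong (_% p) (m+[n∸m]≡n (<⇒≤ (toℕ<n a))) ⟩
    p % p                          ≡⟨ n%n≡0 p ⟩
    0                              ∎)
    where open ≡-Reasoning

  ⊖-⊕-cancel : ∀ a b → (a ⊖ b) ⊕ b ≡ a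
  ⊖-⊕-cancel a b = begin
    (a ⊕ (- b)) ⊕ b  ≡⟨ ⊕-assoc a (- b) b ⟩
    a ⊕ ((- b) ⊕ b)  ≡⟨ cong (a ⊕_) (trans (⊕-comm (- b) b) (⊕-inverseʳ b)) ⟩
    a ⊕ 0#           ≡⟨ ⊕-identityʳ a ⟩
    a                ∎
    where open ≡-Reasoning

  ⊕-⊖-cancel : ∀ a b → (a ⊕ b) ⊖ b ≡ a
  ⊕-⊖-cancel a b = begin
    (a ⊕ b) ⊕ (- b)  ≡⟨ ⊕-assoc a b (- b) ⟩
    a ⊕ (b ⊕ (- b))  ≡⟨ cong (a ⊕_) (⊕-inverseʳ b) ⟩
    a ⊕ 0#           ≡⟨ ⊕-identityʳ a ⟩
    a                ∎
    where open ≡-Reasoning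

  ⊕-⊖-cancelˡ : ∀ a b → b ⊕ (a ⊖ b) ≡ a
  ⊕-⊖-cancelˡ a b = trans (⊕-comm b (a ⊖ b)) (⊖-⊕-cancel a b)

  ⊕-cancelʳ : ∀ {a b} c → a ⊕ c ≡ b ⊕ c → a ≡ b
  ⊕-cancelʳ {a} {b} c eq = trans (sym (⊕-⊖-cancel a c)) (trans (cong (_⊖ c) eq) (⊕-⊖-cancel b c))

  ⊖-involutive : ∀ t a → t ⊖ (t ⊖ a) ≡ a
  ⊖-involutive t a = ⊕-cancelʳ (t ⊖ a) (trans (⊖-⊕-cancel t (t ⊖ a)) (sym (⊕-⊖-cancelˡ t a)))

  ⊖≡0⇒≡ : ∀ {a b} → a ⊖ b ≡ 0# → a ≡ b
  ⊖≡0⇒≡ {a} {b} eq = trans (sym (⊖-⊕-cancel a b)) (trans (cong (_⊕ b) eq) (⊕-identityˡ b))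

  1#≢0# : 2 ≤ p → 1# ≢ 0#
  1#≢0# 2≤p 1≡0 with () ← trans (sym (m<n⇒m%n≡m 2≤p)) (trans (sym (toℕ-mod 1)) (cong toℕ 1≡0))

  ⊗-comm : ∀ a b → a ⊗ b ≡ b ⊗ a
  ⊗-comm a b = cong (_mod p) (*-comm (toℕ a) (toℕ b))

  ⊗-assoc : ∀ a b c → (a ⊗ b) ⊗ c ≡ a ⊗ (b ⊗ c)
  ⊗-assoc a b c = toℕ-injective (begin
    toℕ ((a ⊗ b) ⊗ c)                 ≡⟨ toℕ-⊗ (a ⊗ b) c ⟩
    (toℕ (a ⊗ b) * toℕ c) % p         ≡⟨ cong (λ z → (z * toℕ c) % p) (toℕ-⊗ a b) ⟩
    ((toℕ a * toℕ b) % p * toℕ c) % p ≡⟨ %-absorbˡ-* (toℕ a * toℕ b) (toℕ c) ⟩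
    (toℕ a * toℕ b * toℕ c) % p       ≡⟨ cong (_% p) (*-assoc (toℕ a) (toℕ b) (toℕ c)) ⟩
    (toℕ a * (toℕ b * toℕ c)) % p     ≡⟨ %-absorbʳ-* (toℕ a) (toℕ b * toℕ c) ⟨
    (toℕ a * ((toℕ b * toℕ c) % p)) % p ≡⟨ cong (λ z → (toℕ a * z) % p) (toℕ-⊗ b c) ⟨
    (toℕ a * toℕ (b ⊗ c)) % p         ≡⟨ toℕ-⊗ a (b ⊗ c) ⟨
    toℕ (a ⊗ (b ⊗ c))                 ∎)
    where open ≡-Reasoning

  ⊗-identityˡ : ∀ a → 1# ⊗ a ≡ a
  ⊗-identityˡ a = toℕ-injective (begin
    toℕ (1# ⊗ a)          ≡⟨ toℕ-⊗ 1# a ⟩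
    (toℕ 1# * toℕ a) % p  ≡⟨ cong (λ z → (z * toℕ a) % p) (toℕ-mod 1) ⟩
    (1 % p * toℕ a) % p   ≡⟨ %-absorbˡ-* 1 (toℕ a) ⟩
    (1 * toℕ a) % p       ≡⟨ cong (_% p) (*-identityˡ (toℕ a)) ⟩
    toℕ a % p             ≡⟨ toℕ-%p a ⟩
    toℕ a                 ∎)
    where open ≡-Reasoning

  ⊗-zeroʳ : ∀ a → a ⊗ 0# ≡ 0#
  ⊗-zeroʳ a = cong (_mod p) (*-zeroʳ (toℕ a))

  ⊗-identityʳ : ∀ a → a ⊗ 1# ≡ a
  ⊗-identityʳ a = trans (⊗-comm a 1#) (⊗-identityˡ a)

  ⊗-distribʳ-⊕ : ∀ a b c → (a ⊕ b) ⊗ c ≡ (a ⊗ c) ⊕ (b ⊗ c)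
  ⊗-distribʳ-⊕ a b c = toℕ-injective (begin
    toℕ ((a ⊕ b) ⊗ c)                          ≡⟨ toℕ-⊗ (a ⊕ b) c ⟩
    (toℕ (a ⊕ b) * toℕ c) % p                  ≡⟨ cong (λ z → (z * toℕ c) % p) (toℕ-⊕ a b) ⟩
    ((toℕ a + toℕ b) % p * toℕ c) % p          ≡⟨ %-absorbˡ-* (toℕ a + toℕ b) (toℕ c) ⟩
    ((toℕ a + toℕ b) * toℕ c) % p              ≡⟨ cong (_% p) (*-distribʳ-+ (toℕ c) (toℕ a) (toℕ b)) ⟩
    (toℕ a * toℕ c + toℕ b * toℕ c) % p        ≡⟨ %-distribˡ-+ (toℕ a * toℕ c) (toℕ b * toℕ c) p ⟩
    ((toℕ a * toℕ c) % p + (toℕ b * toℕ c) % p) % p ≡⟨ cong₂ (λ x y → (x + y) % p) (toℕ-⊗ a c) (toℕ-⊗ b c) ⟨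
    (toℕ (a ⊗ c) + toℕ (b ⊗ c)) % p            ≡⟨ toℕ-⊕ (a ⊗ c) (b ⊗ c) ⟨
    toℕ ((a ⊗ c) ⊕ (b ⊗ c))                    ∎)
    where open ≡-Reasoning

  mod-suc : ∀ k → suc k mod p ≡ (k mod p) ⊕ 1#
  mod-suc k = toℕ-injective (begin
    toℕ (suc k mod p)                   ≡⟨ toℕ-mod (suc k) ⟩
    suc k % p                           ≡⟨ cong (_% p) (+-comm 1 k) ⟩
    (k + 1) % p                         ≡⟨ %-distribˡ-+ k 1 p ⟩
    (k % p + 1 % p) % p                 ≡⟨ cong₂ (λ x y → (x + y) % p) (toℕ-mod k) (toℕ-mod 1) ⟨
    (toℕ (k mod p) + toℕ 1#) % p        ≡⟨ toℕ-⊕ (k mod p) 1# ⟨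
    toℕ ((k mod p) ⊕ 1#)                ∎)
    where open ≡-Reasoning

  ℤₚ-induction : (P : Fin p → Set) → P 0# → (∀ c → P c → P (c ⊕ 1#)) → ∀ c → P c
  ℤₚ-induction P P0 Psuc c = subst P (mod-toℕ c) (go (toℕ c))
    where
    go : ∀ k → P (k mod p)
    go zero    = P0
    go (suc k) = subst P (sym (mod-suc k)) (Psuc _ (go k))

  ∣_∣ : (Fin p → Bool) → ℕ
  ∣ X ∣ = countZp p X

  Nonempty : (Fin p → Bool) → Set
  Nonempty X = ∃ λ x → T (X x)

  ∣∣≤p : ∀ X → ∣ X ∣ ≤ p
  ∣∣≤p X = subst (∣ X ∣ ≤_) (length-tabulate id) (count≤length (allFin p))

  ∣full∣≡p : ∀ {X} → (∀ x → T (X x)) → ∣ X ∣ ≡ p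
  ∣full∣≡p full = trans (count-all (allFin p) full) (length-tabulate id)

  ∣∣-cong : ∀ {X Y} → (∀ x → X x ≡ Y x) → ∣ X ∣ ≡ ∣ Y ∣
  ∣∣-cong = count-cong (allFin p)

  ∣∣-mono : ∀ {X Y} → (∀ x → T (X x) → T (Y x)) → ∣ X ∣ ≤ ∣ Y ∣
  ∣∣-mono = count-mono (allFin p)

  ∣∣-∘-↔ : (φ : Fin p ↔ Fin p) (X : Fin p → Bool) → ∣ X ∘ Inverse.to φ ∣ ≡ ∣ X ∣
  ∣∣-∘-↔ = count-∘-↔ (Unique.allFin⁺ p) ∈-allFin

  ∣∣-translate : ∀ X e → ∣ (λ x → X (x ⊕ e)) ∣ ≡ ∣ X ∣
  ∣∣-translate X e = ∣∣-∘-↔ (mk↔ₛ′ (_⊕ e) (_⊖ e) (λ x → ⊖-⊕-cancel x e) (λ x → ⊕-⊖-cancel x e)) X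

  ∣∣-reflect : ∀ X t → ∣ (λ x → X (t ⊖ x)) ∣ ≡ ∣ X ∣
  ∣∣-reflect X t = ∣∣-∘-↔ (mk↔ₛ′ (t ⊖_) (t ⊖_) (⊖-involutive t) (⊖-involutive t)) X

  _+ₛ_ : (Fin p → Bool) → (Fin p → Bool) → (Fin p → Bool)
  (X +ₛ Y) z = any (λ x → X x ∧ Y (z ⊖ x)) (allFin p)

  +ₛ-intro : ∀ X Y {x y} → T (X x) → T (Y y) → T ((X +ₛ Y) (x ⊕ y))
  +ₛ-intro X Y {x} {y} Xx Yy = any⁺ _ (lose (∈-allFin x) (Equivalence.from T-∧ (Xx , subst (T ∘ Y) (sym y≡) Yy)))
    where
    y≡ : (x ⊕ y) ⊖ x ≡ y
    y≡ = trans (cong (_⊖ x) (⊕-comm x y)) (⊕-⊖-cancel y x)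

  +ₛ-elim : ∀ X Y {z} → T ((X +ₛ Y) z) → ∃₂ λ x y → T (X x) × T (Y y) × x ⊕ y ≡ z
  +ₛ-elim X Y {z} z∈X+Y =
    let x , _ , Xx∧Yy = find (any⁻ _ (allFin p) z∈X+Y) ; Xx , Yy = Equivalence.to T-∧ Xx∧Yy in
    x , z ⊖ x , Xx , Yy , ⊕-⊖-cancelˡ z x

  ∣∣≤∣+ₛ∣ : ∀ X Y {y} → T (Y y) → ∣ X ∣ ≤ ∣ X +ₛ Y ∣
  ∣∣≤∣+ₛ∣ X Y {y} Yy = begin
    ∣ X ∣                     ≡⟨ ∣∣-translate X (- y) ⟨
    ∣ (λ x → X (x ⊖ y)) ∣     ≤⟨ ∣∣-mono (λ x Xx → subst (T ∘ (X +ₛ Y)) (⊖-⊕-cancel x y) (+ₛ-intro X Y Xx Yy)) ⟩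
    ∣ X +ₛ Y ∣                ∎
    where open ≤-Reasoning

  ∣∣+∣∣≤p+∣reps∣ : ∀ X Y t → ∣ X ∣ + ∣ Y ∣ ≤ p + ∣ (λ x → X x ∧ Y (t ⊖ x)) ∣
  ∣∣+∣∣≤p+∣reps∣ X Y t = begin
    ∣ X ∣ + ∣ Y ∣                                                   ≡⟨ cong (∣ X ∣ +_) (∣∣-reflect Y t) ⟨
    ∣ X ∣ + ∣ (λ x → Y (t ⊖ x)) ∣                                   ≡⟨ count-∨+count-∧ (allFin p) X (λ x → Y (t ⊖ x)) ⟨
    ∣ (λ x → X x ∨ Y (t ⊖ x)) ∣ + ∣ (λ x → X x ∧ Y (t ⊖ x)) ∣       ≤⟨ +-monoˡ-≤ _ (∣∣≤p (λ x → X x ∨ Y (t ⊖ x))) ⟩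
    p + ∣ (λ x → X x ∧ Y (t ⊖ x)) ∣                                 ∎
    where open ≤-Reasoning

  +ₛ-full : ∀ X Y → p < ∣ X ∣ + ∣ Y ∣ → ∀ t → T ((X +ₛ Y) t)
  +ₛ-full X Y p<∣X∣+∣Y∣ t = any⁺ _ (count-pos⇒Any (allFin p) (+-cancelˡ-< p 0 _ (begin-strict
    p + 0                               ≡⟨ +-identityʳ p ⟩
    p                                   <⟨ p<∣X∣+∣Y∣ ⟩
    ∣ X ∣ + ∣ Y ∣                       ≤⟨ ∣∣+∣∣≤p+∣reps∣ X Y t ⟩
    p + ∣ (λ x → X x ∧ Y (t ⊖ x)) ∣     ∎)))
    where open ≤-Reasoning

  -- Dyson's e-transform
  module e-transform (X Y : Fin p → Bool) (e : Fin p) where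

    X′ Y′ : Fin p → Bool
    X′ x = X x ∨ Y (x ⊖ e)
    Y′ y = Y y ∧ X (y ⊕ e)

    ∣X′∣+∣Y′∣ : ∣ X′ ∣ + ∣ Y′ ∣ ≡ ∣ X ∣ + ∣ Y ∣
    ∣X′∣+∣Y′∣ = begin
      ∣ X′ ∣ + ∣ Y′ ∣                            ≡⟨ cong (∣ X′ ∣ +_) ∣Y′∣≡ ⟩
      ∣ X′ ∣ + ∣ (λ x → X x ∧ Y (x ⊖ e)) ∣       ≡⟨ count-∨+count-∧ (allFin p) X (λ x → Y (x ⊖ e)) ⟩
      ∣ X ∣ + ∣ (λ x → Y (x ⊖ e)) ∣              ≡⟨ cong (∣ X ∣ +_) (∣∣-translate Y (- e)) ⟩
      ∣ X ∣ + ∣ Y ∣                              ∎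
      where
      open ≡-Reasoning
      ∣Y′∣≡ : ∣ Y′ ∣ ≡ ∣ (λ x → X x ∧ Y (x ⊖ e)) ∣
      ∣Y′∣≡ = begin
        ∣ Y′ ∣                                   ≡⟨ ∣∣-translate Y′ (- e) ⟨
        ∣ (λ x → Y (x ⊖ e) ∧ X ((x ⊖ e) ⊕ e)) ∣  ≡⟨ ∣∣-cong (λ x → trans (∧-comm (Y (x ⊖ e)) _) (cong (λ z → X z ∧ Y (x ⊖ e)) (⊖-⊕-cancel x e))) ⟩
        ∣ (λ x → X x ∧ Y (x ⊖ e)) ∣              ∎

    X′+Y′⊆X+Y : ∀ z → T ((X′ +ₛ Y′) z) → T ((X +ₛ Y) z)
    X′+Y′⊆X+Y z z∈X′+Y′ with +ₛ-elim X′ Y′ {z} z∈X′+Y′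
    ... | x , y , X′x , Y′y , x+y≡z with Equivalence.to T-∨ X′x | Equivalence.to T-∧ Y′y
    ... | inj₁ Xx     | Yy , _   = subst (T ∘ (X +ₛ Y)) x+y≡z (+ₛ-intro X Y Xx Yy)
    ... | inj₂ Y[x-e] | _ , X[y+e] = subst (T ∘ (X +ₛ Y)) (trans shuffle x+y≡z) (+ₛ-intro X Y X[y+e] Y[x-e])
      where
      shuffle : (y ⊕ e) ⊕ (x ⊖ e) ≡ x ⊕ y
      shuffle = begin
        (y ⊕ e) ⊕ (x ⊖ e)  ≡⟨ ⊕-assoc y e (x ⊖ e) ⟩
        y ⊕ (e ⊕ (x ⊖ e))  ≡⟨ cong (y ⊕_) (⊕-⊖-cancelˡ x e) ⟩
        y ⊕ x              ≡⟨ ⊕-comm y x ⟩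
        x ⊕ y              ∎
        where open ≡-Reasoning

  module _ (p-prime : Prime p) where

    toℕ-coprime : ∀ {a} → a ≢ 0# → Coprime (toℕ a) p
    toℕ-coprime {a} a≢0 (d∣a , d∣p) with prime⇒irreducible p-prime d∣p
    ... | inj₁ d≡1  = d≡1
    ... | inj₂ refl = contradiction (∣⇒≤ {{≢-nonZero (a≢0 ∘ toℕ-injective)}} d∣a) (<⇒≱ (toℕ<n a))

    ⊗-inverse : ∀ {a} → a ≢ 0# → ∃ λ b → b ⊗ a ≡ 1#
    ⊗-inverse {a} a≢0 with coprime-Bézout (toℕ-coprime a≢0)
    ... | Bézout.+- x y 1+yp≡xa = x mod p , toℕ-injective (begin
      toℕ ((x mod p) ⊗ a)       ≡⟨ toℕ-⊗ (x mod p) a ⟩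
      (toℕ (x mod p) * toℕ a) % p ≡⟨ cong (λ z → (z * toℕ a) % p) (toℕ-mod x) ⟩
      (x % p * toℕ a) % p       ≡⟨ %-absorbˡ-* x (toℕ a) ⟩
      (x * toℕ a) % p           ≡⟨ cong (_% p) 1+yp≡xa ⟨
      (1 + y * p) % p           ≡⟨ [m+kn]%n≡m%n 1 y p ⟩
      1 % p                     ≡⟨ toℕ-mod 1 ⟨
      toℕ 1#                    ∎)
      where open ≡-Reasoning
    ... | Bézout.-+ x y 1+xa≡yp = (n * x) mod p , toℕ-injective (begin
      toℕ (((n * x) mod p) ⊗ a)      ≡⟨ toℕ-⊗ ((n * x) mod p) a ⟩
      (toℕ ((n * x) mod p) * toℕ a) % p ≡⟨ cong (λ z → (z * toℕ a) % p) (toℕ-mod (n * x)) ⟩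
      ((n * x) % p * toℕ a) % p      ≡⟨ %-absorbˡ-* (n * x) (toℕ a) ⟩
      (n * x * toℕ a) % p            ≡⟨ [m+n]%n≡m%n (n * x * toℕ a) p ⟨
      (n * x * toℕ a + p) % p        ≡⟨ cong (_% p) (key x (toℕ a) y 1+xa≡yp) ⟩
      (1 + n * y * p) % p            ≡⟨ [m+kn]%n≡m%n 1 (n * y) p ⟩
      1 % p                          ≡⟨ toℕ-mod 1 ⟨
      toℕ 1#                         ∎)
      where
      open ≡-Reasoning
      -- −x is an inverse modulo p, represented by n x = (p − 1) x
      key : ∀ x a y → 1 + x * a ≡ y * p → n * x * a + p ≡ 1 + n * y * p
      key x a y eq = begin
        n * x * a + suc n       ≡⟨ lemma₁ n x a ⟩
        suc (n * (1 + x * a))   ≡⟨ cong (λ z → suc (n * z)) eq ⟩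
        suc (n * (y * p))       ≡⟨ lemma₂ n y ⟩
        1 + n * y * p           ∎
        where
        lemma₁ : ∀ n x a → n * x * a + suc n ≡ suc (n * (1 + x * a))
        lemma₁ = solve-∀
        lemma₂ : ∀ n y → suc (n * (y * suc n)) ≡ 1 + n * y * suc n
        lemma₂ = solve-∀

    ⊗-cancelˡ : ∀ {c a b} → c ≢ 0# → c ⊗ a ≡ c ⊗ b → a ≡ b
    ⊗-cancelˡ {c} {a} {b} c≢0 eq = begin
      a                  ≡⟨ ⊗-identityˡ a ⟨
      1# ⊗ a             ≡⟨ cong (_⊗ a) c⁻¹c≡1 ⟨
      (c⁻¹ ⊗ c) ⊗ a      ≡⟨ ⊗-assoc c⁻¹ c a ⟩
      c⁻¹ ⊗ (c ⊗ a)      ≡⟨ cong (c⁻¹ ⊗_) eq ⟩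
      c⁻¹ ⊗ (c ⊗ b)      ≡⟨ ⊗-assoc c⁻¹ c b ⟨
      (c⁻¹ ⊗ c) ⊗ b      ≡⟨ cong (_⊗ b) c⁻¹c≡1 ⟩
      1# ⊗ b             ≡⟨ ⊗-identityˡ b ⟩
      b                  ∎
      where
      open ≡-Reasoning
      c⁻¹ = proj₁ (⊗-inverse c≢0)
      c⁻¹c≡1 = proj₂ (⊗-inverse c≢0)

    -- y = a ⊕ ((y ⊖ a) ⊗ d⁻¹) ⊗ d is reached from a by adding d repeatedly
    ⊕-closed⇒full : (X : Fin p → Bool) {a d : Fin p} → d ≢ 0# → T (X a) →
                    (∀ x → T (X x) → T (X (x ⊕ d))) → ∀ y → T (X y)
    ⊕-closed⇒full X {a} {d} d≢0 Xa closed y =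
      subst (T ∘ X) (trans (cong (a ⊕_) d-multiple) (⊕-⊖-cancelˡ y a)) (X[a+cd] ((y ⊖ a) ⊗ d⁻¹))
      where
      d⁻¹ = proj₁ (⊗-inverse d≢0)
      d-multiple : ((y ⊖ a) ⊗ d⁻¹) ⊗ d ≡ y ⊖ a
      d-multiple = trans (⊗-assoc (y ⊖ a) d⁻¹ d) (trans (cong ((y ⊖ a) ⊗_) (proj₂ (⊗-inverse d≢0))) (⊗-identityʳ (y ⊖ a)))
      step : ∀ c → (a ⊕ (c ⊗ d)) ⊕ d ≡ a ⊕ ((c ⊕ 1#) ⊗ d)
      step c = begin
        (a ⊕ (c ⊗ d)) ⊕ d           ≡⟨ ⊕-assoc a (c ⊗ d) d ⟩
        a ⊕ ((c ⊗ d) ⊕ d)           ≡⟨ cong (λ z → a ⊕ ((c ⊗ d) ⊕ z)) (⊗-identityˡ d) ⟨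
        a ⊕ ((c ⊗ d) ⊕ (1# ⊗ d))    ≡⟨ cong (a ⊕_) (⊗-distribʳ-⊕ c 1# d) ⟨
        a ⊕ ((c ⊕ 1#) ⊗ d)          ∎
        where open ≡-Reasoning
      X[a+cd] : ∀ c → T (X (a ⊕ (c ⊗ d)))
      X[a+cd] = ℤₚ-induction (λ c → T (X (a ⊕ (c ⊗ d))))
        (subst (T ∘ X) (sym (⊕-identityʳ a)) Xa)
        (λ c Xc → subst (T ∘ X) (step c) (closed _ Xc))

    ⊕-double-injective : 3 ≤ p → ∀ {x y} → x ⊕ x ≡ y ⊕ y → x ≡ y
    ⊕-double-injective 3≤p {x} {y} eq = ⊗-cancelˡ 2≢0 (trans (double x) (trans eq (sym (double y))))
      where
      double : ∀ a → (1# ⊕ 1#) ⊗ a ≡ a ⊕ a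
      double a = trans (⊗-distribʳ-⊕ 1# 1# a) (cong₂ _⊕_ (⊗-identityˡ a) (⊗-identityˡ a))
      toℕ-2 : toℕ (1# ⊕ 1#) ≡ 2
      toℕ-2 = begin
        toℕ (1# ⊕ 1#)            ≡⟨ toℕ-⊕ 1# 1# ⟩
        (toℕ 1# + toℕ 1#) % p    ≡⟨ cong (λ z → (z + z) % p) (toℕ-mod 1) ⟩
        (1 % p + 1 % p) % p      ≡⟨ cong (λ z → (z + z) % p) (m<n⇒m%n≡m (≤-trans (s≤s (s≤s z≤n)) 3≤p)) ⟩
        2 % p                    ≡⟨ m<n⇒m%n≡m 3≤p ⟩
        2                        ∎
        where open ≡-Reasoning
      2≢0 : 1# ⊕ 1# ≢ 0#
      2≢0 eq₂ with () ← trans (sym toℕ-2) (cong toℕ eq₂)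

    restricted-+ₛ-full : 3 ≤ p → ∀ X → p + 2 ≤ ∣ X ∣ + ∣ X ∣ → ∀ t →
                         ∃₂ λ x y → x ≢ y × T (X x) × T (X y) × x ⊕ y ≡ t
    restricted-+ₛ-full 3≤p X big t =
      let x₁ , x₂ , x₁≢x₂ , rep₁ , rep₂ = count≥2⇒distinct (Unique.allFin⁺ p) two-reps in
      choose x₁≢x₂ rep₁ rep₂ (x₁ ≟F (t ⊖ x₁)) (x₂ ≟F (t ⊖ x₂))
      where
      two-reps : 2 ≤ ∣ (λ x → X x ∧ X (t ⊖ x)) ∣
      two-reps = +-cancelˡ-≤ p 2 _ (≤-trans big (∣∣+∣∣≤p+∣reps∣ X X t))
      Result = ∃₂ λ x y → x ≢ y × T (X x) × T (X y) × x ⊕ y ≡ t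
      use : ∀ {x} → T (X x ∧ X (t ⊖ x)) → x ≢ t ⊖ x → Result
      use {x} rep x≢t-x = let Xx , X[t-x] = Equivalence.to T-∧ rep in x , t ⊖ x , x≢t-x , Xx , X[t-x] , ⊕-⊖-cancelˡ t x
      double≡ : ∀ {x} → x ≡ t ⊖ x → x ⊕ x ≡ t
      double≡ {x} eq = trans (cong (x ⊕_) eq) (⊕-⊖-cancelˡ t x)
      -- x₁ and x₂ cannot both be halves of t
      choose : ∀ {x₁ x₂} → x₁ ≢ x₂ → T (X x₁ ∧ X (t ⊖ x₁)) → T (X x₂ ∧ X (t ⊖ x₂)) →
               Dec (x₁ ≡ t ⊖ x₁) → Dec (x₂ ≡ t ⊖ x₂) → Result
      choose _     rep₁ _    (no x₁≢) _        = use rep₁ x₁≢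
      choose _     _    rep₂ (yes _)  (no x₂≢) = use rep₂ x₂≢
      choose x₁≢x₂ _    _    (yes x₁≡) (yes x₂≡) =
        contradiction (⊕-double-injective 3≤p (trans (double≡ x₁≡) (sym (double≡ x₂≡)))) x₁≢x₂

    Escape : (X Y : Fin p → Bool) → Set
    Escape X Y = ∃ λ a → ∃ λ b → ∃ λ b′ → T (X a) × T (Y b) × T (Y b′) × ¬ T (X (b′ ⊕ (a ⊖ b)))

    escape? : ∀ X Y → Dec (Escape X Y)
    escape? X Y = any? λ a → any? λ b → any? λ b′ →
      T? (X a) ×-dec T? (Y b) ×-dec T? (Y b′) ×-dec ¬? (T? (X (b′ ⊕ (a ⊖ b))))

    -- without an escape, X is closed under adding b′ ⊖ b for any b, b′ ∈ Y
    ¬escape⇒full : ∀ X Y → ¬ Escape X Y → Nonempty X → ∀ {b b′} → b ≢ b′ → T (Y b) → T (Y b′) →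
                   ∀ x → T (X x)
    ¬escape⇒full X Y ¬esc (a , Xa) {b} {b′} b≢b′ Yb Yb′ =
      ⊕-closed⇒full X (b≢b′ ∘ sym ∘ ⊖≡0⇒≡) Xa closed
      where
      closed : ∀ x → T (X x) → T (X (x ⊕ (b′ ⊖ b)))
      closed x Xx = subst (T ∘ X) shuffle
        (decidable-stable (T? _) λ ¬X → ¬esc (x , b , b′ , Xx , Yb , Yb′ , ¬X))
        where
        shuffle : b′ ⊕ (x ⊖ b) ≡ x ⊕ (b′ ⊖ b)
        shuffle = begin
          b′ ⊕ (x ⊕ (- b))   ≡⟨ ⊕-assoc b′ x (- b) ⟨
          (b′ ⊕ x) ⊕ (- b)   ≡⟨ cong (_⊕ (- b)) (⊕-comm b′ x) ⟩
          (x ⊕ b′) ⊕ (- b)   ≡⟨ ⊕-assoc x b′ (- b) ⟩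
          x ⊕ (b′ ⊕ (- b))   ∎
          where open ≡-Reasoning

    cauchy-davenport : ∀ X Y → Nonempty X → Nonempty Y → p ⊓ (∣ X ∣ + ∣ Y ∣ ∸ 1) ≤ ∣ X +ₛ Y ∣
    cauchy-davenport X Y = go ∣ Y ∣ X Y ≤-refl
      where
      go : ∀ k X Y → ∣ Y ∣ ≤ k → Nonempty X → Nonempty Y → p ⊓ (∣ X ∣ + ∣ Y ∣ ∸ 1) ≤ ∣ X +ₛ Y ∣
      go zero    X Y ∣Y∣≤0 _ (y , Yy) = contradiction ∣Y∣≤0 (<⇒≱ (Any⇒count-pos (allFin p) (lose (∈-allFin y) Yy)))
      go (suc k) X Y ∣Y∣≤k+1 neX (y , Yy) with ∣ Y ∣ ≤? 1 | all? (T? ∘ X)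
      ... | yes ∣Y∣≤1 | _ = begin
        p ⊓ (∣ X ∣ + ∣ Y ∣ ∸ 1)  ≤⟨ m⊓n≤n p _ ⟩
        ∣ X ∣ + ∣ Y ∣ ∸ 1        ≤⟨ ∸-monoˡ-≤ 1 (+-monoʳ-≤ ∣ X ∣ ∣Y∣≤1) ⟩
        ∣ X ∣ + 1 ∸ 1            ≡⟨ m+n∸n≡m ∣ X ∣ 1 ⟩
        ∣ X ∣                    ≤⟨ ∣∣≤∣+ₛ∣ X Y Yy ⟩
        ∣ X +ₛ Y ∣               ∎
        where open ≤-Reasoning
      ... | no _ | yes X-full = begin
        p ⊓ (∣ X ∣ + ∣ Y ∣ ∸ 1)  ≤⟨ m⊓n≤m p _ ⟩
        p                        ≡⟨ ∣full∣≡p (λ z → subst (T ∘ (X +ₛ Y)) (⊖-⊕-cancel z y) (+ₛ-intro X Y (X-full (z ⊖ y)) Yy)) ⟨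
        ∣ X +ₛ Y ∣               ∎
        where open ≤-Reasoning
      ... | no ∣Y∣≰1 | no X-not-full with escape? X Y
      ... | no ¬esc =
        let b , b′ , b≢b′ , Yb , Yb′ = count≥2⇒distinct (Unique.allFin⁺ p) (≰⇒> ∣Y∣≰1) in
        contradiction (¬escape⇒full X Y ¬esc neX b≢b′ Yb Yb′) X-not-full
      ... | yes (a , b , b′ , Xa , Yb , Yb′ , ¬X[b′+e]) = begin
        p ⊓ (∣ X ∣ + ∣ Y ∣ ∸ 1)    ≡⟨ cong (λ m → p ⊓ (m ∸ 1)) ∣X′∣+∣Y′∣ ⟨
        p ⊓ (∣ X′ ∣ + ∣ Y′ ∣ ∸ 1)  ≤⟨ go k X′ Y′ ∣Y′∣≤k (a , Equivalence.from T-∨ (inj₁ Xa)) (b , Y′b) ⟩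
        ∣ X′ +ₛ Y′ ∣               ≤⟨ ∣∣-mono (X′+Y′⊆X+Y) ⟩
        ∣ X +ₛ Y ∣                 ∎
        where
        open ≤-Reasoning
        open e-transform X Y (a ⊖ b)
        Y′b : T (Y′ b)
        Y′b = Equivalence.from T-∧ (Yb , subst (T ∘ X) (sym (⊕-⊖-cancelˡ a b)) Xa)
        ∣Y′∣≤k : ∣ Y′ ∣ ≤ k
        ∣Y′∣≤k = s≤s⁻¹ (≤-trans (count-mono-< (allFin p) (λ _ → proj₁ ∘ Equivalence.to T-∧) (∈-allFin b′)
                                   (¬X[b′+e] ∘ proj₂ ∘ Equivalence.to T-∧) Yb′) ∣Y∣≤k+1)

-- Coordinates on ℤₚ² adapted to a coset indexing

module Coordinates (n : ℕ) where
  open ℤₚ n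

  Additive : (G p → Fin p) → Set
  Additive ι = ∀ x y → ι (x ⊞ y) ≡ ι x ⊕ ι y

  -- φ (i , t) is the t-th element of the coset with index i
  record AdaptedCoordinates (ι : G p → Fin p) : Set where
    field
      φ    : (Fin p × Fin p) ↔ G p
      ι-φ  : ∀ i t → ι (Inverse.to φ (i , t)) ≡ i
      φ-⊞  : ∀ u v → Inverse.to φ (u ⊞ v) ≡ Inverse.to φ u ⊞ Inverse.to φ v

  module AdditiveIndex {ι : G p → Fin p} (additive : Additive ι) where

    ι-0 : ι (0# , 0#) ≡ 0#
    ι-0 = ⊕-cancelʳ (ι (0# , 0#)) (trans (sym (additive (0# , 0#) (0# , 0#))) (sym (⊕-identityˡ _)))

    ι-split : ∀ a b → ι (a , b) ≡ ι (a , 0#) ⊕ ι (0# , b)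
    ι-split a b = trans (cong ι (cong₂ _,_ (sym (⊕-identityʳ a)) (sym (⊕-identityˡ b)))) (additive (a , 0#) (0# , b))

    ι-vertical : ∀ c → ι (0# , c) ≡ c ⊗ ι (0# , 1#)
    ι-vertical = ℤₚ-induction (λ c → ι (0# , c) ≡ c ⊗ ι (0# , 1#)) ι-0 λ c ih → begin
      ι (0# , c ⊕ 1#)                          ≡⟨ cong (λ z → ι (z , c ⊕ 1#)) (⊕-identityˡ 0#) ⟨
      ι ((0# , c) ⊞ (0# , 1#))                 ≡⟨ additive (0# , c) (0# , 1#) ⟩
      ι (0# , c) ⊕ ι (0# , 1#)                 ≡⟨ cong₂ _⊕_ ih (sym (⊗-identityˡ _)) ⟩
      (c ⊗ ι (0# , 1#)) ⊕ (1# ⊗ ι (0# , 1#))   ≡⟨ ⊗-distribʳ-⊕ c 1# _ ⟨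
      (c ⊕ 1#) ⊗ ι (0# , 1#)                   ∎
      where open ≡-Reasoning

  -- with v = ι (0 , 1) invertible, ι (a , b) = ι (a , 0) + b v can be solved for b
  coordinates-vertical : Prime p → ∀ {ι} → Additive ι → ι (0# , 1#) ≢ 0# → AdaptedCoordinates ι
  coordinates-vertical p-prime {ι} additive v≢0 = record { φ = φ ; ι-φ = ι-to ; φ-⊞ = to-⊞ }
      where
      open AdditiveIndex {ι} additive
      v = ι (0# , 1#)
      v⁻¹ = proj₁ (⊗-inverse p-prime v≢0)

      to : Fin p × Fin p → G p
      to (i , a) = (a , (i ⊖ ι (a , 0#)) ⊗ v⁻¹)

      from : G p → Fin p × Fin p
      from (a , b) = (ι (a , b) , a)

      ⊗v⁻¹⊗v : ∀ c → (c ⊗ v⁻¹) ⊗ v ≡ c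
      ⊗v⁻¹⊗v c = trans (⊗-assoc c v⁻¹ v) (trans (cong (c ⊗_) (proj₂ (⊗-inverse p-prime v≢0))) (⊗-identityʳ c))

      ⊗v⊗v⁻¹ : ∀ c → (c ⊗ v) ⊗ v⁻¹ ≡ c
      ⊗v⊗v⁻¹ c = trans (⊗-assoc c v v⁻¹) (trans (cong (c ⊗_) (trans (⊗-comm v v⁻¹) (proj₂ (⊗-inverse p-prime v≢0)))) (⊗-identityʳ c))

      ι-to : ∀ i a → ι (to (i , a)) ≡ i
      ι-to i a = begin
        ι (a , (i ⊖ ι (a , 0#)) ⊗ v⁻¹)                       ≡⟨ ι-split a _ ⟩
        ι (a , 0#) ⊕ ι (0# , (i ⊖ ι (a , 0#)) ⊗ v⁻¹)         ≡⟨ cong (ι (a , 0#) ⊕_) (ι-vertical _) ⟩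
        ι (a , 0#) ⊕ (((i ⊖ ι (a , 0#)) ⊗ v⁻¹) ⊗ v)          ≡⟨ cong (ι (a , 0#) ⊕_) (⊗v⁻¹⊗v _) ⟩
        ι (a , 0#) ⊕ (i ⊖ ι (a , 0#))                        ≡⟨ ⊕-⊖-cancelˡ i (ι (a , 0#)) ⟩
        i                                                    ∎
        where open ≡-Reasoning

      to-from : ∀ x → to (from x) ≡ x
      to-from (a , b) = cong (a ,_) (begin
        (ι (a , b) ⊖ ι (a , 0#)) ⊗ v⁻¹                  ≡⟨ cong (λ z → (z ⊖ ι (a , 0#)) ⊗ v⁻¹) (trans (ι-split a b) (⊕-comm (ι (a , 0#)) (ι (0# , b)))) ⟩
        ((ι (0# , b) ⊕ ι (a , 0#)) ⊖ ι (a , 0#)) ⊗ v⁻¹  ≡⟨ cong (_⊗ v⁻¹) (⊕-⊖-cancel (ι (0# , b)) (ι (a , 0#))) ⟩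
        ι (0# , b) ⊗ v⁻¹                                ≡⟨ cong (_⊗ v⁻¹) (ι-vertical b) ⟩
        (b ⊗ v) ⊗ v⁻¹                                   ≡⟨ ⊗v⊗v⁻¹ b ⟩
        b                                               ∎)
        where open ≡-Reasoning

      from-to : ∀ u → from (to u) ≡ u
      from-to (i , a) = cong (_, a) (ι-to i a)

      φ : (Fin p × Fin p) ↔ G p
      φ = mk↔ₛ′ to from to-from from-to

      to-⊞ : ∀ u w → to (u ⊞ w) ≡ to u ⊞ to w
      to-⊞ u w = begin
        to (u ⊞ w)                      ≡⟨ cong₂ (λ x y → to (x ⊞ y)) (from-to u) (from-to w) ⟨
        to (from (to u) ⊞ from (to w))  ≡⟨ cong (λ i → to (i , proj₁ (to u) ⊕ proj₁ (to w))) (additive (to u) (to w)) ⟨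
        to (from (to u ⊞ to w))         ≡⟨ to-from (to u ⊞ to w) ⟩
        to u ⊞ to w                     ∎
        where open ≡-Reasoning

  adapted-coordinates : Prime p → ∀ {ι} → Additive ι → (∃ λ x → ι x ≢ 0#) → AdaptedCoordinates ι
  adapted-coordinates p-prime {ι} additive ((a , b) , ι[a,b]≢0) =
    choose (ι (0# , 1#) ≟F 0#) (ι (1# , 0#) ≟F 0#)
    where
    choose : Dec (ι (0# , 1#) ≡ 0#) → Dec (ι (1# , 0#) ≡ 0#) → AdaptedCoordinates ι
    choose (no v≢0) _        = coordinates-vertical p-prime additive v≢0
    choose (yes _)  (no u≢0) = record
      { φ   = ×-comm (Fin p) (Fin p) ↔-∘ φ
      ; ι-φ = ι-φ
      ; φ-⊞ = λ u w → cong swap (φ-⊞ u w)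
      }
      where open AdaptedCoordinates (coordinates-vertical p-prime {ι ∘ swap} (λ x y → additive (swap x) (swap y)) u≢0)
    choose (yes v≡0) (yes u≡0) = contradiction ι[a,b]≡0 ι[a,b]≢0
      where
      open AdditiveIndex {ι} additive
      open AdditiveIndex {ι ∘ swap} (λ x y → additive (swap x) (swap y)) using () renaming (ι-vertical to ι-horizontal)
      ι[a,b]≡0 : ι (a , b) ≡ 0#
      ι[a,b]≡0 = begin
        ι (a , b)                                ≡⟨ ι-split a b ⟩
        ι (a , 0#) ⊕ ι (0# , b)                  ≡⟨ cong₂ _⊕_ (ι-horizontal a) (ι-vertical b) ⟩
        (a ⊗ ι (1# , 0#)) ⊕ (b ⊗ ι (0# , 1#))    ≡⟨ cong₂ (λ u v → (a ⊗ u) ⊕ (b ⊗ v)) u≡0 v≡0 ⟩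
        (a ⊗ 0#) ⊕ (b ⊗ 0#)                      ≡⟨ cong₂ _⊕_ (⊗-zeroʳ a) (⊗-zeroʳ b) ⟩
        0# ⊕ 0#                                  ≡⟨ ⊕-identityˡ 0# ⟩
        0#                                       ∎
        where open ≡-Reasoning

-- Rows of A and of 2̂A

module Rows (n : ℕ) (p-prime : Prime (suc n)) (A : G (suc n) → Bool)
            {ι : G (suc n) → Fin (suc n)} (coords : Coordinates.AdaptedCoordinates n ι) where
  open ℤₚ n
  open Coordinates.AdaptedCoordinates coords

  point : Fin p → Fin p → G p
  point i t = Inverse.to φ (i , t)

  row : (G p → Bool) → Fin p → Fin p → Bool
  row X i t = X (point i t)

  elems-unique : Unique (elems p)
  elems-unique = Unique.cartesianProduct⁺ (Unique.allFin⁺ p) (Unique.allFin⁺ p)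

  ∈-elems : ∀ x → x ∈ elems p
  ∈-elems (a , b) = ∈-cartesianProduct⁺ (∈-allFin a) (∈-allFin b)

  card-by-rows : ∀ X → card p X ≡ ∑ (allFin p) (λ i → ∣ row X i ∣)
  card-by-rows X = begin
    card p X                               ≡⟨ count-∘-↔ elems-unique ∈-elems φ X ⟨
    count (elems p) (X ∘ Inverse.to φ)     ≡⟨ count-cartesianProduct (allFin p) (allFin p) (X ∘ Inverse.to φ) ⟩
    ∑ (allFin p) (λ i → ∣ row X i ∣)       ∎
    where open ≡-Reasoning

  card-part : ∀ i → card p (part A ι i) ≡ ∣ row A i ∣
  card-part i = begin
    card p (part A ι i)                                            ≡⟨ card-by-rows (part A ι i) ⟩
    ∑ (allFin p) (λ j → ∣ row (part A ι i) j ∣)                    ≡⟨ ∑-cong (allFin p) row-j ⟩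
    ∑ (allFin p) (λ j → if ⌊ j ≟F i ⌋ then ∣ row A j ∣ else 0)     ≡⟨ ∑-pick _≟F_ _ (Unique.allFin⁺ p) (∈-allFin i) off-diagonal ⟩
    (if ⌊ i ≟F i ⌋ then ∣ row A i ∣ else 0)                         ≡⟨ cong (λ b → if b then ∣ row A i ∣ else 0) (trans (isYes≗does (i ≟F i)) (dec-true (i ≟F i) refl)) ⟩
    ∣ row A i ∣                                                    ∎
    where
    open ≡-Reasoning
    row-j : ∀ j → ∣ row (part A ι i) j ∣ ≡ (if ⌊ j ≟F i ⌋ then ∣ row A j ∣ else 0)
    row-j j = trans (∣∣-cong (λ t → cong (λ k → A (point j t) ∧ ⌊ k ≟F i ⌋) (ι-φ j t)))
                    (count-∧-const (allFin p) (row A j) ⌊ j ≟F i ⌋)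
    off-diagonal : ∀ {j} → j ≢ i → (if ⌊ j ≟F i ⌋ then ∣ row A j ∣ else 0) ≡ 0
    off-diagonal {j} j≢i = cong (λ b → if b then ∣ row A j ∣ else 0) (trans (isYes≗does (j ≟F i)) (dec-false (j ≟F i) j≢i))

  sumHat-intro : ∀ {x y} → T (A x) → T (A y) → x ≢ y → T (sumHat p A (x ⊞ y))
  sumHat-intro {x} {y} Ax Ay x≢y = any⁺ summands (lose (∈-elems x) (any⁺ (summand x) (lose (∈-elems y) x+y)))
    where
    summand : G p → G p → Bool
    summand a₁ a₂ = A a₁ ∧ A a₂ ∧ not (a₁ ≟G a₂) ∧ ((a₁ ⊞ a₂) ≟G (x ⊞ y))
    summands : G p → Bool
    summands a₁ = any (summand a₁) (elems p)
    x+y : T (summand x y)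
    x+y = Equivalence.from (T-∧ {A x}) (Ax , Equivalence.from (T-∧ {A y}) (Ay ,
          Equivalence.from (T-∧ {not (x ≟G y)}) (fromWitnessFalse {a? = ≡-dec _≟F_ _≟F_ x y} x≢y ,
                                                 fromWitness {a? = ≡-dec _≟F_ _≟F_ (x ⊞ y) (x ⊞ y)} refl)))

  sumHat-rows : ∀ {i j x y} → T (row A i x) → T (row A j y) → (i , x) ≢ (j , y) →
                T (row (sumHat p A) (i ⊕ j) (x ⊕ y))
  sumHat-rows {i} {j} {x} {y} Ax Ay ix≢jy = subst (T ∘ sumHat p A) (sym (φ-⊞ (i , x) (j , y)))
    (sumHat-intro Ax Ay (ix≢jy ∘ point-injective))
    where
    point-injective : point i x ≡ point j y → (i , x) ≡ (j , y)
    point-injective eq = trans (sym (Inverse.strictlyInverseʳ φ (i , x))) (trans (cong (Inverse.from φ) eq) (Inverse.strictlyInverseʳ φ (j , y)))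

  row-+ₛ⊆row-sumHat : ∀ {i j} → i ≢ j → ∀ t → T ((row A i +ₛ row A j) t) → T (row (sumHat p A) (i ⊕ j) t)
  row-+ₛ⊆row-sumHat {i} {j} i≢j t t∈ =
    let x , y , Ax , Ay , x+y≡t = +ₛ-elim (row A i) (row A j) {t} t∈ in
    subst (T ∘ row (sumHat p A) (i ⊕ j)) x+y≡t (sumHat-rows Ax Ay (i≢j ∘ cong proj₁))

  row-0-full : 3 ≤ p → p + 2 ≤ ∣ row A 0# ∣ + ∣ row A 0# ∣ → ∀ t → T (row (sumHat p A) 0# t)
  row-0-full 3≤p big t =
    let x , y , x≢y , Ax , Ay , x+y≡t = restricted-+ₛ-full p-prime 3≤p (row A 0#) big t in
    subst₂ (λ i u → T (row (sumHat p A) i u)) (⊕-identityˡ 0#) x+y≡t (sumHat-rows Ax Ay (x≢y ∘ cong proj₂))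

  row-+ₛ⊆row-sumHat₀ : ∀ {i} → i ≢ 0# → ∀ t → T ((row A 0# +ₛ row A i) t) → T (row (sumHat p A) i t)
  row-+ₛ⊆row-sumHat₀ {i} i≢0 t = subst (λ j → T (row (sumHat p A) j t)) (⊕-identityˡ i) ∘ row-+ₛ⊆row-sumHat (i≢0 ∘ sym) t

  row-full : ∀ {i} → i ≢ 0# → p < ∣ row A 0# ∣ + ∣ row A i ∣ → ∀ t → T (row (sumHat p A) i t)
  row-full {i} i≢0 big t = row-+ₛ⊆row-sumHat₀ i≢0 t (+ₛ-full (row A 0#) (row A i) big t)

  row-lower-bound : ∀ {i} → i ≢ 0# → Nonempty (row A 0#) → Nonempty (row A i) →
                    p ⊓ (∣ row A 0# ∣ + ∣ row A i ∣ ∸ 1) ≤ ∣ row (sumHat p A) i ∣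
  row-lower-bound {i} i≢0 ne₀ neᵢ = begin
    p ⊓ (∣ row A 0# ∣ + ∣ row A i ∣ ∸ 1)  ≤⟨ cauchy-davenport p-prime (row A 0#) (row A i) ne₀ neᵢ ⟩
    ∣ row A 0# +ₛ row A i ∣               ≤⟨ ∣∣-mono (row-+ₛ⊆row-sumHat₀ i≢0) ⟩
    ∣ row (sumHat p A) i ∣                ∎
    where open ≤-Reasoning

  a : Fin p → ℕ
  a i = card p (part A ι i)

  a₀ : ℕ
  a₀ = a 0#

  large small : Fin p → Bool
  large i = not ⌊ i ≟F 0ₚ p ⌋ ∧ ⌊ p ≤? a₀ + a i ∸ 1 ⌋
  small i = not ⌊ i ≟F 0ₚ p ⌋ ∧ any (part A ι i) (elems p) ∧ ⌊ a₀ + a i ∸ 1 <? p ⌋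

  a≤p : ∀ i → a i ≤ p
  a≤p i = subst (_≤ p) (sym (card-part i)) (∣∣≤p (row A i))

  nonempty-row : ∀ {i} → 0 < a i → Nonempty (row A i)
  nonempty-row {i} 0<aᵢ = satisfied (count-pos⇒Any (allFin p) (subst (0 <_) (card-part i) 0<aᵢ))

  module Accounting (∣A∣≡2p+1 : card p A ≡ 2 * p + 1) (p+3≤2a₀ : p + 3 ≤ 2 * a₀) (ℓ≡1 : countZp p large ≡ 1)
                    {β : Fin p} (β≢0 : β ≢ 0ₚ p) (β-large : p ≤ a₀ + a β ∸ 1) where

    R : Fin p → ℕ
    R i = ∣ row (sumHat p A) i ∣

    0<a₀ : 0 < a₀
    0<a₀ = n≢0⇒n>0 λ a₀≡0 → contradiction (≤-trans (m≤n+m 3 p) (subst (λ m → p + 3 ≤ 2 * m) a₀≡0 p+3≤2a₀)) λ ()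

    3≤p : 3 ≤ p
    3≤p = +-cancelˡ-≤ p 3 p (begin
      p + 3      ≤⟨ p+3≤2a₀ ⟩
      2 * a₀     ≤⟨ *-monoʳ-≤ 2 (a≤p 0#) ⟩
      2 * p      ≡⟨ cong (p +_) (+-identityʳ p) ⟩
      p + p      ∎)
      where open ≤-Reasoning

    R₀≡p : R 0# ≡ p
    R₀≡p = ∣full∣≡p (row-0-full 3≤p (begin
      p + 2                            ≤⟨ +-monoʳ-≤ p (n≤1+n 2) ⟩
      p + 3                            ≤⟨ p+3≤2a₀ ⟩
      2 * a₀                           ≡⟨ cong (a₀ +_) (+-identityʳ a₀) ⟩
      a₀ + a₀                          ≡⟨ cong₂ _+_ (card-part 0#) (card-part 0#) ⟩
      ∣ row A 0# ∣ + ∣ row A 0# ∣      ∎))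
      where open ≤-Reasoning

    Rβ≡p : R β ≡ p
    Rβ≡p = ∣full∣≡p (row-full β≢0 (subst (p <_) (cong₂ _+_ (card-part 0#) (card-part β))
                                     (≤∸1⇒< (≤-trans 0<a₀ (m≤m+n a₀ (a β))) β-large)))
      where
      ≤∸1⇒< : ∀ {m n} → 0 < n → m ≤ n ∸ 1 → m < n
      ≤∸1⇒< {n = suc n} _ m≤n = s≤s m≤n

    only-large-β : ∀ {j} → T (large j) → j ≡ β
    only-large-β Lj = count≡1⇒unique _≟F_ (Unique.allFin⁺ p) ℓ≡1 (∈-allFin β) (∈-allFin _) Lβ Lj
      where
      Lβ : T (large β)
      Lβ = Equivalence.from (T-∧ {not ⌊ β ≟F 0# ⌋}) (fromWitnessFalse {a? = β ≟F 0#} β≢0 , fromWitness {a? = p ≤? a₀ + a β ∸ 1} β-large)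

    small-row : ∀ {j} → T (small j) → j ≢ 0# × 0 < a j × a₀ + a j ∸ 1 < p
    small-row {j} Sj =
      let j≢0 , rest = Equivalence.to (T-∧ {not ⌊ j ≟F 0# ⌋}) Sj
          A∩Hⱼ≠∅ , a₀+aⱼ∸1<p = Equivalence.to (T-∧ {any (part A ι j) (elems p)}) rest
      in toWitnessFalse {a? = j ≟F 0#} j≢0 , Any⇒count-pos (elems p) (any⁻ _ (elems p) A∩Hⱼ≠∅) ,
         toWitness {a? = a₀ + a j ∸ 1 <? p} a₀+aⱼ∸1<p

    empty-row : ∀ {j} → j ≢ 0# → j ≢ β → ¬ T (small j) → a j ≡ 0
    empty-row {j} j≢0 j≢β ¬Sj = n≤0⇒n≡0 (≮⇒≥ λ 0<aⱼ → ¬Sj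
      (Equivalence.from (T-∧ {not ⌊ j ≟F 0# ⌋}) (fromWitnessFalse {a? = j ≟F 0#} j≢0 ,
       Equivalence.from (T-∧ {any (part A ι j) (elems p)}) (any⁺ (part A ι j) (count-pos⇒Any (elems p) 0<aⱼ) ,
                                                           fromWitness {a? = a₀ + a j ∸ 1 <? p} a₀+aⱼ∸1<p))))
      where
      a₀+aⱼ∸1<p : a₀ + a j ∸ 1 < p
      a₀+aⱼ∸1<p = ≰⇒> λ p≤a₀+aⱼ∸1 → j≢β (only-large-β
        (Equivalence.from (T-∧ {not ⌊ j ≟F 0# ⌋}) (fromWitnessFalse {a? = j ≟F 0#} j≢0 , fromWitness {a? = p ≤? a₀ + a j ∸ 1} p≤a₀+aⱼ∸1)))

    small-row-bound : ∀ {j} → T (small j) → (a₀ ∸ 1) + a j ≤ R j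
    small-row-bound {j} Sj = begin
      (a₀ ∸ 1) + a j                         ≡⟨ +-∸-comm {a₀} (a j) {1} 0<a₀ ⟨
      a₀ + a j ∸ 1                           ≡⟨ m≥n⇒m⊓n≡n {p} {a₀ + a j ∸ 1} (<⇒≤ a₀+aⱼ∸1<p) ⟨
      p ⊓ (a₀ + a j ∸ 1)                     ≡⟨ cong (λ m → p ⊓ (m ∸ 1)) (cong₂ _+_ (card-part 0#) (card-part j)) ⟩
      p ⊓ (∣ row A 0# ∣ + ∣ row A j ∣ ∸ 1)   ≤⟨ row-lower-bound j≢0 (nonempty-row 0<a₀) (nonempty-row 0<aⱼ) ⟩
      R j                                    ∎
      where
      open ≤-Reasoning
      j≢0 = proj₁ (small-row Sj)
      0<aⱼ = proj₁ (proj₂ (small-row Sj))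
      a₀+aⱼ∸1<p = proj₂ (proj₂ (small-row Sj))

    others : List (Fin p)
    others = filter (λ j → ¬? (j ≟F β)) (filter (λ j → ¬? (j ≟F 0#)) (allFin p))

    ∈-others : ∀ {j} → j ∈ others → j ≢ 0# × j ≢ β
    ∈-others j∈ =
      let j∈′ , j≢β = ∈-filter⁻ (λ j → ¬? (j ≟F β)) {xs = filter (λ j → ¬? (j ≟F 0#)) (allFin p)} j∈ in
      proj₂ (∈-filter⁻ (λ j → ¬? (j ≟F 0#)) {xs = allFin p} j∈′) , j≢β

    ∑-by-rows : ∀ w → ∑ (allFin p) w ≡ w 0# + (w β + ∑ others w)
    ∑-by-rows w = ∑-↭ w (↭-trans (↭-remove _≟F_ (Unique.allFin⁺ p) (∈-allFin 0#))
      (↭-prep 0# (↭-remove _≟F_ (Unique.filter⁺ (λ j → ¬? (j ≟F 0#)) (Unique.allFin⁺ p)) (∈-filter⁺ (λ j → ¬? (j ≟F 0#)) (∈-allFin β) β≢0))))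

    s≡count-others : countZp p small ≡ count others small
    s≡count-others = trans (∑-by-rows (𝟙 ∘ small))
      (cong₂ (λ b b′ → 𝟙 b + (𝟙 b′ + count others small)) (¬T⇒≡false λ S₀ → proj₁ (small-row {0#} S₀) refl)
                                                           (¬T⇒≡false λ Sβ → <⇒≱ (proj₂ (proj₂ (small-row {β} Sβ))) β-large))

    a-total : a₀ + (a β + ∑ others a) ≡ 2 * p + 1
    a-total = begin
      a₀ + (a β + ∑ others a)             ≡⟨ ∑-by-rows a ⟨
      ∑ (allFin p) a                      ≡⟨ ∑-cong (allFin p) card-part ⟩
      ∑ (allFin p) (λ i → ∣ row A i ∣)    ≡⟨ card-by-rows A ⟨
      card p A                            ≡⟨ ∣A∣≡2p+1 ⟩
      2 * p + 1                           ∎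
      where open ≡-Reasoning

    other-row-size : ∀ {j} → j ∈ others → a j ≤ (if small j then p else 0)
    other-row-size {j} j∈ = by-cases (small j) refl
      where
      by-cases : ∀ b → small j ≡ b → a j ≤ (if b then p else 0)
      by-cases true  _      = a≤p j
      by-cases false Sj≡ff  = ≤-reflexive (empty-row (proj₁ (∈-others j∈)) (proj₂ (∈-others j∈)) (subst T Sj≡ff))

    other-row-bound : ∀ {j} → j ∈ others → (if small j then a₀ ∸ 1 else 0) + a j ≤ R j
    other-row-bound {j} j∈ = by-cases (small j) refl
      where
      by-cases : ∀ b → small j ≡ b → (if b then a₀ ∸ 1 else 0) + a j ≤ R j
      by-cases true  Sj≡tt = small-row-bound (subst T (sym Sj≡tt) _)
      by-cases false Sj≡ff = subst (_≤ R j) (sym (empty-row (proj₁ (∈-others j∈)) (proj₂ (∈-others j∈)) (subst T Sj≡ff))) z≤n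

    others-bound : ∑ others a ≤ countZp p small * p
    others-bound = begin
      ∑ others a                                  ≤⟨ ∑-mono others other-row-size ⟩
      ∑ others (λ j → if small j then p else 0)   ≡⟨ ∑-if others small p ⟩
      count others small * p                      ≡⟨ cong (_* p) s≡count-others ⟨
      countZp p small * p                         ∎
      where open ≤-Reasoning

    sumHat-bound : p + (p + (countZp p small * (a₀ ∸ 1) + ∑ others a)) ≤ card p (sumHat p A)
    sumHat-bound = begin
      p + (p + (countZp p small * (a₀ ∸ 1) + ∑ others a))
        ≡⟨ cong₂ (λ x y → x + (y + (countZp p small * (a₀ ∸ 1) + ∑ others a))) R₀≡p Rβ≡p ⟨
      R 0# + (R β + (countZp p small * (a₀ ∸ 1) + ∑ others a))
        ≡⟨ cong (λ m → R 0# + (R β + m)) (cong₂ _+_ (trans (cong (_* (a₀ ∸ 1)) s≡count-others) (sym (∑-if others small (a₀ ∸ 1)))) refl) ⟩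
      R 0# + (R β + (∑ others (λ j → if small j then a₀ ∸ 1 else 0) + ∑ others a))
        ≡⟨ cong (λ m → R 0# + (R β + m)) (∑-+ others (λ j → if small j then a₀ ∸ 1 else 0) a) ⟨
      R 0# + (R β + ∑ others (λ j → (if small j then a₀ ∸ 1 else 0) + a j))
        ≤⟨ +-monoʳ-≤ (R 0#) (+-monoʳ-≤ (R β) (∑-mono others other-row-bound)) ⟩
      R 0# + (R β + ∑ others R)
        ≡⟨ ∑-by-rows R ⟨
      ∑ (allFin p) R
        ≡⟨ card-by-rows (sumHat p A) ⟨
      card p (sumHat p A)
        ∎
      where open ≤-Reasoning

row-count-arithmetic : ∀ {p s a₀ aβ rest S} → p + 3 ≤ 2 * a₀ → aβ ≤ a₀ → a₀ ≤ p → aβ ≤ p →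
  a₀ + (aβ + rest) ≡ 2 * p + 1 → p + (p + (s * (a₀ ∸ 1) + rest)) ≤ S → S ≤ 4 * p ∸ 1 → rest ≤ s * p →
  s ≡ 1 ⊎ (s ≡ 2 × aβ ≡ a₀)
row-count-arithmetic {p} {a₀ = zero} p+3≤0 _ _ _ _ _ _ _ = contradiction (≤-trans (m≤n+m 3 p) p+3≤0) λ ()
row-count-arithmetic {zero} {a₀ = suc _} _ _ () _ _ _ _ _
row-count-arithmetic {suc q} {s} {suc c} {aβ} {rest} {S} p+3≤2a₀ aβ≤a₀ a₀≤p aβ≤p total big S≤ rest≤ =
  by-cases s key rest≤
  where
  -- adding a₀ + aβ + rest = 2p + 1 to both sides of the bound on S
  key : s * c + 2 ≤ suc c + aβ
  key = +-cancelˡ-≤ (q + 3 * suc q) _ _ (begin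
    q + 3 * suc q + (s * c + 2)                          ≡⟨ ring₁ q (s * c) ⟩
    suc q + suc q + s * c + (2 * suc q + 1)              ≡⟨ cong (suc q + suc q + s * c +_) total ⟨
    suc q + suc q + s * c + (suc c + (aβ + rest))        ≡⟨ ring₂ (suc q) (s * c) c aβ rest ⟩
    suc q + (suc q + (s * c + rest)) + (suc c + aβ)      ≤⟨ +-monoˡ-≤ (suc c + aβ) (≤-trans big S≤) ⟩
    q + 3 * suc q + (suc c + aβ)                         ∎)
    where
    open ≤-Reasoning
    ring₁ : ∀ q x → q + 3 * suc q + (x + 2) ≡ suc q + suc q + x + (2 * suc q + 1)
    ring₁ = solve-∀
    ring₂ : ∀ p x c b r → p + p + x + (suc c + (b + r)) ≡ p + (p + (x + r)) + (suc c + b)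
    ring₂ = solve-∀

  by-cases : ∀ s → s * c + 2 ≤ suc c + aβ → rest ≤ s * suc q → s ≡ 1 ⊎ (s ≡ 2 × aβ ≡ suc c)
  by-cases zero _ rest≤0 = contradiction (begin-strict
    suc q + suc q                  <⟨ n<1+n _ ⟩
    suc (suc q + suc q)            ≡⟨ ring q ⟩
    2 * suc q + 1                  ≡⟨ total ⟨
    suc c + (aβ + rest)            ≡⟨ cong (λ r → suc c + (aβ + r)) (n≤0⇒n≡0 rest≤0) ⟩
    suc c + (aβ + 0)               ≡⟨ cong (suc c +_) (+-identityʳ aβ) ⟩
    suc c + aβ                     ∎) (≤⇒≯ (+-mono-≤ a₀≤p aβ≤p))
    where
    open ≤-Reasoning
    ring : ∀ q → suc (suc q + suc q) ≡ 2 * suc q + 1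
    ring = solve-∀
  by-cases 1 _ _ = inj₁ refl
  by-cases 2 key₂ _ = inj₂ (refl , ≤-antisym aβ≤a₀ (+-cancelˡ-≤ (suc c) _ _ (subst (_≤ suc c + aβ) (ring c) key₂)))
    where
    ring : ∀ c → 2 * c + 2 ≡ suc c + suc c
    ring = solve-∀
  by-cases (suc (suc (suc s))) key₃ _ = contradiction (≤-trans (m≤n+m 3 (suc q)) p+3≤2a₀) (λ 3≤2a₀ → 3≰2 (subst (λ a → 3 ≤ 2 * suc a) c≡0 3≤2a₀))
    where
    ring : ∀ s c → (3 + s) * c + 2 ≡ suc c + suc c + (c + s * c)
    ring = solve-∀
    c≡0 : c ≡ 0
    c≡0 = n≤0⇒n≡0 (≤-trans (m≤m+n c (s * c)) (+-cancelˡ-≤ (suc c + suc c) _ 0 (begin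
      suc c + suc c + (c + s * c)   ≡⟨ ring s c ⟨
      (3 + s) * c + 2               ≤⟨ key₃ ⟩
      suc c + aβ                    ≤⟨ +-monoʳ-≤ (suc c) aβ≤a₀ ⟩
      suc c + suc c                 ≡⟨ +-identityʳ _ ⟨
      suc c + suc c + 0             ∎)))
      where open ≤-Reasoning
    3≰2 : ¬ 3 ≤ 2 * 1
    3≰2 (s≤s (s≤s ()))

lemma3p7 : (p : ℕ) .{{_ : NonZero p}} → Prime p → 5 ≤ p →
  (A : G p → Bool) → card p A ≡ 2 * p + 1 →
  (H : G p → Bool) → IsSubgroup p H → card p H ≡ p →
  (ι : G p → Zp p) → CosetIndexing p H ι →
  let a : Zp p → ℕ
      a i = card p (part A ι i)
      a₀ = a (0ₚ p)
      ℓ = countZp p (λ i → not ⌊ i ≟F 0ₚ p ⌋ ∧ ⌊ p ≤? a₀ + a i ∸ 1 ⌋)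
      s = countZp p (λ i → not ⌊ i ≟F 0ₚ p ⌋ ∧ any (part A ι i) (elems p) ∧ ⌊ a₀ + a i ∸ 1 <? p ⌋)
  in (∀ i → a i ≤ a₀) → p + 3 ≤ 2 * a₀ → ℓ ≡ 1 →
     (β : Zp p) → ¬ (β ≡ 0ₚ p) → p ≤ a₀ + a β ∸ 1 →
     card p (sumHat p A) ≤ 4 * p ∸ 1 →
     (s ≡ 1) ⊎ ((s ≡ 2) × (a β ≡ a₀))
lemma3p7 zero _ ()
-- H enters only through ι: the coset indexing alone determines the rows A_i
lemma3p7 (suc n) p-prime 5≤p A ∣A∣≡2p+1 _ _ _ ι ι-indexes a≤a₀ p+3≤2a₀ ℓ≡1 β β≢0 β-large ∣2̂A∣≤4p-1 =
  row-count-arithmetic p+3≤2a₀ (a≤a₀ β) (a≤p (0ₚ (suc n))) (a≤p β) a-total sumHat-bound ∣2̂A∣≤4p-1 others-bound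
  where
  open ℤₚ n using (1#; 1#≢0#)
  x₁ = proj₁ (CosetIndexing.onto ι-indexes 1#)
  ιx₁≢0 : ι x₁ ≢ 0ₚ (suc n)
  ιx₁≢0 = 1#≢0# (≤-trans (s≤s (s≤s z≤n)) 5≤p) ∘ trans (sym (proj₂ (CosetIndexing.onto ι-indexes 1#)))
  open Rows n p-prime A (Coordinates.adapted-coordinates n p-prime {ι} (CosetIndexing.additive ι-indexes) (x₁ , ιx₁≢0))
  open Accounting ∣A∣≡2p+1 p+3≤2a₀ ℓ≡1 β≢0 β-large
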